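{- Every LSGA net is a structural conflict net.
   Context: Petri net $N=(S,T,F,M_0,\ell)$; ${}^\bullet x(y)=F(y,x)$, $x^\bullet(y)=F(x,y)$; $M[G\rangle M'$ iff ${}^\bullet G\le M$, $M'=M-{}^\bullet G+G^\bullet$; $t\smile u$ iff some reachable marking enables the step $\{t\}+\{u\}$. $N$ is a structural conflict net iff $t\smile u$ implies ${}^\bullet t\cap{}^\bullet u=\emptyset$. A component with interface is $(N,I,O)$ with $I,O\subseteq S$ disjoint and $o^\bullet=\emptyset$ for $o\in O$; it is sequential iff some $Q\subseteq S\setminus(I\cup O)$ has $\sum_{q\in Q}F(q,t)=\sum_{q\in Q}F(t,q)=1$ for all $t\in T$ and $\sum_{q\in Q}M_0(q)=1$. For components $((S_k,T_k,F_k,M_{0k},\ell_k),I_k,O_k)$, $k\in\mathfrak K$, with $(S_k\cup T_k)\cap(S_l\cup T_l)=(I_k\cup O_k)\cap(I_l\cup O_l)$ and $I_k\cap I_l=\emptyset$ for $k\ne l$, the asynchronous parallel composition is $((\bigcup S_k,\bigcup T_k,\bigcup F_k,\sum M_{0k},\bigcup\ell_k),\bigcup I_k,\bigcup O_k\setminus\bigcup I_k)$. $N$ is an LSGA net iff $(N,I,O)$ is such a composition of sequential components for some $I,O$. -}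

module Defs where

open import Data.Nat using (ℕ; _+_; _∸_; _≤_; _<_)
open import Data.List using (List; []; _∷_; map)
open import Data.Nat.ListAction using (sum)
open import Data.List.Membership.Propositional using (_∉_)
open import Data.List.Relation.Unary.Unique.Propositional using (Unique)
open import Data.Product using (Σ; ∃; ∃-syntax; _×_; _,_)
open import Data.Sum using (_⊎_)
open import Data.Empty using (⊥)
open import Relation.Nullary using (¬_)
open import Relation.Binary.PropositionalEquality using (_≡_; _≢_)

-- Petri nets N = (S, T, F, M₀, ℓ).  S and T are disjoint (distinct types).
-- The flow function F : (S×T ∪ T×S) → ℕ is split into
--   pre  s t = F(s,t)    and    post t s = F(t,s).
record Net : Set₁ where
  field
    S   : Set
    T   : Set
    Act : Set
    pre  : S → T → ℕ
    post : T → S → ℕ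
    M₀   : S → ℕ
    ℓ    : T → Act

module _ (N : Net) where
  open Net N

  Marking : Set
  Marking = S → ℕ

  -- A step is a finite multiset of transitions, represented as a list.
  Step : Set
  Step = List T

  preStep : Step → S → ℕ
  preStep G s = sum (map (λ t → pre s t) G)

  postStep : Step → S → ℕ
  postStep G s = sum (map (λ t → post t s) G)

  Enables : Marking → Step → Set
  Enables M G = ∀ s → preStep G s ≤ M s

  Fires : Marking → Step → Marking → Set
  Fires M G M' = Enables M G × (∀ s → M' s ≡ (M s ∸ preStep G s) + postStep G s)

  data Reachable : Marking → Set where
    init : Reachable M₀
    fire : ∀ {M M'} (G : Step) → Reachable M → Fires M G M' → Reachable M'

  Concurrent : T → T → Set
  Concurrent t u = Σ Marking λ M → Reachable M × Enables M (t ∷ u ∷ [])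

  DisjointPresets : T → T → Set
  DisjointPresets t u = ∀ s → 0 < pre s t → 0 < pre s u → ⊥

  StructuralConflictNet : Set
  StructuralConflictNet = ∀ t u → Concurrent t u → DisjointPresets t u

-- Σ_{a ∈ P} f a = 1  (literal meaning for a sum of naturals)
SumIsOne : {A : Set} → (A → Set) → (A → ℕ) → Set
SumIsOne {A} P f =
  Σ A λ a → P a × f a ≡ 1 × (∀ b → P b → b ≢ a → f b ≡ 0)

-- Σ_{k ∈ K} g k = n  (the sum exists, i.e. g has finite support, and equals n)
SumsTo : {K : Set} → (K → ℕ) → ℕ → Set
SumsTo {K} g n =
  Σ (List K) λ ks → Unique ks × (∀ k → k ∉ ks → g k ≡ 0) × n ≡ sum (map g ks)

-- N presented as an asynchronous parallel composition of components
-- with interfaces (N_k, I_k, O_k), k ∈ K.  Each component is described as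
-- a subnet of N: places Sₖ k, transitions Tₖ k, flow = restriction of F,
-- labelling = restriction of ℓ, and its own initial marking M₀ₖ k.
record Composition (N : Net) : Set₁ where
  open Net N
  field
    K   : Set
    Sₖ  : K → S → Set
    Tₖ  : K → T → Set
    Iₖ  : K → S → Set
    Oₖ  : K → S → Set
    M₀ₖ : K → S → ℕ
    I⊆S     : ∀ k s → Iₖ k s → Sₖ k s
    O⊆S     : ∀ k s → Oₖ k s → Sₖ k s
    I∩O     : ∀ k s → Iₖ k s → Oₖ k s → ⊥
    M₀ₖ⊆S   : ∀ k s → ¬ Sₖ k s → M₀ₖ k s ≡ 0
    O-noPost : ∀ k s t → Oₖ k s → Tₖ k t → pre s t ≡ 0
    S-overlap : ∀ k l → k ≢ l → ∀ s → Sₖ k s → Sₖ l s →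
                (Iₖ k s ⊎ Oₖ k s) × (Iₖ l s ⊎ Oₖ l s)
    T-overlap : ∀ k l → k ≢ l → ∀ t → Tₖ k t → Tₖ l t → ⊥
    I-disj    : ∀ k l → k ≢ l → ∀ s → Iₖ k s → Iₖ l s → ⊥
    -- N is the composition: S = ⋃ S_k, T = ⋃ T_k, F = ⋃ F_k, M₀ = Σ M₀ₖ
    S-cover  : ∀ s → ∃[ k ] Sₖ k s
    T-cover  : ∀ t → ∃[ k ] Tₖ k t
    pre-in   : ∀ s t → 0 < pre s t → ∃[ k ] (Sₖ k s × Tₖ k t)
    post-in  : ∀ t s → 0 < post t s → ∃[ k ] (Sₖ k s × Tₖ k t)
    M₀-sum   : ∀ s → SumsTo (λ k → M₀ₖ k s) (M₀ s)

module _ {N : Net} (C : Composition N) where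
  open Net N
  open Composition C

  Sequential : K → Set₁
  Sequential k =
    Σ (S → Set) λ Q →
      (∀ q → Q q → Sₖ k q × ¬ Iₖ k q × ¬ Oₖ k q) ×
      (∀ t → Tₖ k t → SumIsOne Q (λ q → pre q t) × SumIsOne Q (λ q → post t q)) ×
      SumIsOne Q (M₀ₖ k)

LSGA : Net → Set₁
LSGA N = Σ (Composition N) λ C → ∀ k → Sequential C k

module Submission where

-- Let t and u be concurrently enabled at a reachable marking and share a
-- preplace s.  The arcs s → t and s → u lie in components k and l.
--
-- * If k ≠ l, then s is shared by two components, hence an interface place
--   of both; it is not an output place of either (output places have no
--   outgoing arcs), so it is an input place of both, contradicting the
--   disjointness of input interfaces  (shared-preplace-impossible).
-- * If k = l, let Q be the set of places witnessing that component k is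
--   sequential.  Places of Q are private to k, so transitions outside k do
--   not touch Q, while each transition of k moves exactly one token inside Q.
--   Hence every reachable marking carries exactly one token on Q
--   (reachable-oneToken), and t, u cannot both take a token from Q at once
--   (no-autoconcurrency).
--
-- Since
-- nothing about the net is decidable, case distinctions are made under a
-- double negation, which is harmless because the goal is a contradiction.

open import Defs
open import Level using (0ℓ)
open import Data.Nat using (ℕ; _+_; _∸_; _≤_; _<_)
open import Data.Nat.Properties
  using (_≟_; n≢0⇒n>0; m<n⇒n≢0; n>0⇒n≢0; m+n≤o⇒n≤o; m+n≤o⇒m≤o∸n; 0∸n≡0; +-identityʳ)
open import Data.List using (List; []; _∷_; map)
open import Data.Nat.ListAction using (sum)
open import Data.List.Relation.Unary.All as All using (All; []; _∷_)
open import Data.List.Relation.Unary.AllPairs using ([]; _∷_)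
open import Data.List.Relation.Unary.Unique.Propositional using (Unique)
open import Data.List.Relation.Unary.Any using (here; there)
open import Data.List.Membership.Propositional using (_∉_)
open import Data.Product using (∃-syntax; _×_; _,_; proj₁; proj₂)
open import Data.Sum using (_⊎_; inj₁; inj₂; [_,_])
open import Data.Empty using (⊥; ⊥-elim)
open import Effect.Monad using (RawMonad)
open import Relation.Nullary using (¬_; Dec; yes; no)
open import Relation.Nullary.Decidable.Core using (decidable-stable; ¬¬-excluded-middle)
open import Relation.Nullary.Negation using (¬¬-Monad; ¬¬-map)
open import Relation.Binary.PropositionalEquality
  using (_≡_; _≢_; refl; sym; trans; cong; cong₂; subst; ≢-sym)

open RawMonad (¬¬-Monad {0ℓ}) using (_>>=_; pure)

ℕ-stable : {m n : ℕ} → ¬ ¬ m ≡ n → m ≡ n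
ℕ-stable {m} {n} = decidable-stable (m ≟ n)

token⇒marked : ∀ {m n} → n ≡ 1 → n ≤ m → m ≢ 0
token⇒marked refl = m<n⇒n≢0

module Tokens {P : Set} (Q : P → Set) where

  Neutral : (P → ℕ) → Set
  Neutral f = ∀ q → Q q → f q ≡ 0

  OneToken : (P → ℕ) → Set
  OneToken = SumIsOne Q

  _≤Q_ : (P → ℕ) → (P → ℕ) → Set
  f ≤Q g = ∀ q → Q q → f q ≤ g q

  Balanced : (P → ℕ) → (P → ℕ) → Set
  Balanced p o = (Neutral p × Neutral o) ⊎ (OneToken p × OneToken o)

  oneToken-cong : ∀ {f g} → (∀ q → Q q → f q ≡ g q) → OneToken f → OneToken g
  oneToken-cong f≗g (c , Qc , fc≡1 , rest) =
    c , Qc , trans (sym (f≗g c Qc)) fc≡1 , λ b Qb b≢c → trans (sym (f≗g b Qb)) (rest b Qb b≢c)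

  neutral-+ : ∀ {f g} → Neutral f → Neutral g → Neutral (λ q → f q + g q)
  neutral-+ nf ng q Qq = cong₂ _+_ (nf q Qq) (ng q Qq)

  oneToken+neutral : ∀ {f g} → OneToken f → Neutral g → OneToken (λ q → f q + g q)
  oneToken+neutral {f} of ng =
    oneToken-cong (λ q Qq → sym (trans (cong (f q +_) (ng q Qq)) (+-identityʳ (f q)))) of

  neutral+oneToken : ∀ {f g} → Neutral f → OneToken g → OneToken (λ q → f q + g q)
  neutral+oneToken {g = g} nf og = oneToken-cong (λ q Qq → sym (cong (_+ g q) (nf q Qq))) og

  marked⇒centre : ∀ {M} (one : OneToken M) {q} → Q q → M q ≢ 0 → ¬ q ≢ proj₁ one
  marked⇒centre (_ , _ , _ , rest) Qq Mq≢0 q≢c = Mq≢0 (rest _ Qq q≢c)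

  drained : ∀ {M p} → OneToken M → OneToken p → p ≤Q M → Neutral (λ q → M q ∸ p q)
  drained {p = p} oneM@(_ , _ , Mc≡1 , _) (a , Qa , pa≡1 , _) p≤M q Qq =
    ℕ-stable λ Mq∸pq≢0 →
      marked⇒centre oneM Qq (λ Mq≡0 → Mq∸pq≢0 (trans (cong (_∸ p q) Mq≡0) (0∸n≡0 (p q))))
        λ { refl → marked⇒centre oneM Qa (token⇒marked pa≡1 (p≤M a Qa))
          λ { refl → Mq∸pq≢0 (cong₂ _∸_ Mc≡1 pa≡1) } }

  no-two-tokens : ∀ {M f g} → OneToken M → OneToken f → OneToken g →
                  (λ q → f q + g q) ≤Q M → ⊥
  no-two-tokens {f = f} oneM (a , Qa , fa≡1 , _) og f+g≤M =
    token⇒marked fa≡1 (m+n≤o⇒m≤o∸n (f a) (f+g≤M a Qa))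
      (drained oneM og (λ q Qq → m+n≤o⇒n≤o (f q) (f+g≤M q Qq)) a Qa)

  -- Two balanced patterns enabled together at a one-token marking add up to a
  -- balanced pattern: at most one of them moves the token.
  balanced-+ : ∀ {M p o p′ o′} → OneToken M → (λ q → p q + p′ q) ≤Q M →
               Balanced p o → Balanced p′ o′ → Balanced (λ q → p q + p′ q) (λ q → o q + o′ q)
  balanced-+ _ _ (inj₁ (np , nₒ)) (inj₁ (np′ , nₒ′)) = inj₁ (neutral-+ np np′ , neutral-+ nₒ nₒ′)
  balanced-+ _ _ (inj₁ (np , nₒ)) (inj₂ (op′ , oo′)) =
    inj₂ (neutral+oneToken np op′ , neutral+oneToken nₒ oo′)
  balanced-+ _ _ (inj₂ (op , oo)) (inj₁ (np′ , nₒ′)) =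
    inj₂ (oneToken+neutral op np′ , oneToken+neutral oo nₒ′)
  balanced-+ oneM bound (inj₂ (op , _)) (inj₂ (op′ , _)) = ⊥-elim (no-two-tokens oneM op op′ bound)

  fire-oneToken : ∀ {M p o} → OneToken M → p ≤Q M → Balanced p o →
                  OneToken (λ q → M q ∸ p q + o q)
  fire-oneToken {M} oneM _ (inj₁ (np , nₒ)) =
    oneToken-cong (λ q Qq → sym (trans (cong₂ (λ x y → M q ∸ x + y) (np q Qq) (nₒ q Qq))
                                       (+-identityʳ (M q)))) oneM
  fire-oneToken {o = o} oneM p≤M (inj₂ (op , oo)) =
    oneToken-cong (λ q Qq → sym (cong (_+ o q) (drained oneM op p≤M q Qq))) oo

-- This identifies M₀ on the
-- private places of a component with that component's initial marking.
sum-single : {A : Set} (g : A → ℕ) {a : A} {xs : List A} → Unique xs →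
             (∀ x → x ≢ a → g x ≡ 0) → (a ∉ xs → g a ≡ 0) → sum (map g xs) ≡ g a
sum-single g [] vanish absent = sym (absent λ ())
sum-single g {a} {x ∷ xs} (x∉xs ∷ unique) vanish absent =
  ℕ-stable λ wrong → ¬¬-excluded-middle {A = x ≡ a} λ where
    (yes refl) → wrong (trans (cong (g a +_) (sum-zero (All.map (λ a≢y → vanish _ (≢-sym a≢y)) x∉xs)))
                              (+-identityʳ (g a)))
    (no x≢a) → wrong (trans (cong (_+ sum (map g xs)) (vanish x x≢a))
                            (sum-single g unique vanish λ a∉xs →
                              absent λ { (here a≡x) → x≢a (sym a≡x) ; (there a∈xs) → a∉xs a∈xs }))
  where
  sum-zero : ∀ {ys} → All (λ y → g y ≡ 0) ys → sum (map g ys) ≡ 0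
  sum-zero [] = refl
  sum-zero (gy≡0 ∷ zeros) = cong₂ _+_ gy≡0 (sum-zero zeros)

module _ {N : Net} (C : Composition N) where
  open Net N
  open Composition C

  -- Two different components cannot both have an arc from a place s to their
  -- own transitions: s would have to be an input place of both.
  shared-preplace-impossible : ∀ {k l s t u} → k ≢ l → Sₖ k s → Sₖ l s → Tₖ k t → Tₖ l u →
                               0 < pre s t → 0 < pre s u → ⊥
  shared-preplace-impossible {k} {l} {s} {t} {u} k≢l Sks Sls Tkt Tlu s∈•t s∈•u
    with S-overlap k l k≢l s Sks Sls
  ... | inj₁ Iks , inj₁ Ils = I-disj k l k≢l s Iks Ils
  ... | inj₂ Oks , _ = n>0⇒n≢0 s∈•t (O-noPost k s t Oks Tkt)
  ... | _ , inj₂ Ols = n>0⇒n≢0 s∈•u (O-noPost l s u Ols Tlu)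

  module SequentialComponent (k : K) (seq : Sequential C k) where

    Q : S → Set
    Q = proj₁ seq

    interior : ∀ q → Q q → Sₖ k q × ¬ Iₖ k q × ¬ Oₖ k q
    interior = proj₁ (proj₂ seq)

    arcs : ∀ t → Tₖ k t → SumIsOne Q (λ q → pre q t) × SumIsOne Q (post t)
    arcs = proj₁ (proj₂ (proj₂ seq))

    initial : SumIsOne Q (M₀ₖ k)
    initial = proj₂ (proj₂ (proj₂ seq))

    open Tokens Q

    -- Places of Q are not interface places, hence belong to no other component.
    private-place : ∀ {q k′} → Q q → Sₖ k′ q → ¬ k′ ≢ k
    private-place {q} {k′} Qq Sk′q k′≢k =
      let (Skq , ¬Ikq , ¬Okq) = interior q Qq
      in [ ¬Ikq , ¬Okq ] (proj₂ (S-overlap k′ k k′≢k q Sk′q Skq))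

    -- An arc of N between a place of Q and a transition lies in some component,
    -- which must be k.
    arc-free : ∀ {q t n} → Q q → (0 < n → ∃[ k′ ] (Sₖ k′ q × Tₖ k′ t)) → ¬ Tₖ k t → n ≡ 0
    arc-free Qq arc-in ¬Tkt = ℕ-stable λ n≢0 →
      let (_ , Sk′q , Tk′t) = arc-in (n≢0⇒n>0 n≢0)
      in private-place Qq Sk′q λ { refl → ¬Tkt Tk′t }

    transition-balanced : ∀ t → ¬ ¬ Balanced (λ q → pre q t) (post t)
    transition-balanced t = ¬¬-map by-membership ¬¬-excluded-middle
      where
      by-membership : Dec (Tₖ k t) → Balanced (λ q → pre q t) (post t)
      by-membership (yes Tkt) = inj₂ (arcs t Tkt)
      by-membership (no ¬Tkt) = inj₁ ( (λ q Qq → arc-free Qq (pre-in q t) ¬Tkt)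
                                     , (λ q Qq → arc-free Qq (post-in t q) ¬Tkt))

    step-balanced : ∀ {M} → OneToken M → ∀ G → preStep N G ≤Q M →
                    ¬ ¬ Balanced (preStep N G) (postStep N G)
    step-balanced oneM [] _ = pure (inj₁ ((λ _ _ → refl) , (λ _ _ → refl)))
    step-balanced oneM (t ∷ G) bound = do
      bt ← transition-balanced t
      bG ← step-balanced oneM G (λ q Qq → m+n≤o⇒n≤o (pre q t) (bound q Qq))
      pure (balanced-+ oneM bound bt bG)

    -- M₀ agrees with M₀ₖ k on Q, since no other component marks a place of Q.
    initial-oneToken : OneToken M₀
    initial-oneToken = oneToken-cong M₀ₖ≗M₀ initial
      where
      M₀ₖ≗M₀ : ∀ q → Q q → M₀ₖ k q ≡ M₀ q
      M₀ₖ≗M₀ q Qq with M₀-sum q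
      ... | ks , unique , outside , M₀q≡sum =
        sym (trans M₀q≡sum (sum-single (λ k′ → M₀ₖ k′ q) unique unmarked (outside k)))
        where
        unmarked : ∀ k′ → k′ ≢ k → M₀ₖ k′ q ≡ 0
        unmarked k′ k′≢k = M₀ₖ⊆S k′ q λ Sk′q → private-place Qq Sk′q k′≢k

    reachable-oneToken : ∀ {M} → Reachable N M → ¬ ¬ OneToken M
    reachable-oneToken init = pure initial-oneToken
    reachable-oneToken (fire G R (enabled , firing)) = do
      oneM ← reachable-oneToken R
      bG ← step-balanced oneM G (λ q _ → enabled q)
      pure (oneToken-cong (λ q _ → sym (firing q)) (fire-oneToken oneM (λ q _ → enabled q) bG))

    no-autoconcurrency : ∀ {t u M} → Tₖ k t → Tₖ k u → Reachable N M → ¬ Enables N M (t ∷ u ∷ [])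
    no-autoconcurrency {t} {u} {M} Tkt Tku R enabled = reachable-oneToken R λ oneM →
      no-two-tokens oneM (proj₁ (arcs t Tkt)) (proj₁ (arcs u Tku))
        λ q _ → subst (λ x → pre q t + x ≤ M q) (+-identityʳ (pre q u)) (enabled q)

corollary4p14 : (N : Net) → LSGA N → StructuralConflictNet N
corollary4p14 N (C , sequential) t u (M , R , enabled) s s∈•t s∈•u
  with Composition.pre-in C s t s∈•t | Composition.pre-in C s u s∈•u
... | k , Sks , Tkt | l , Sls , Tlu = ¬¬-excluded-middle {A = k ≡ l} λ where
  (yes refl) → SequentialComponent.no-autoconcurrency C k (sequential k) Tkt Tlu R enabled
  (no k≢l) → shared-preplace-impossible C k≢l Sks Sls Tkt Tlu s∈•t s∈•u
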